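{- Let $A$ be a binary matrix that has an optimal binary decomposition $A=U\cdot V$ such that every row of $V$ is a row of $A$. If in addition $A$ has the Unique base rows sums property, then the set of columns of $U$ spans every base of $A$ (with respect to the binary rank), and consequently $A$ has the Augmentation property for the binary rank.
   Context: A binary matrix has entries in $\{0,1\}$. The binary rank $R_{binary}(A)$ of an $n\times m$ binary matrix $A$ is the minimal $k$ such that $A=X\cdot Y$ with $X$ an $n\times k$ and $Y$ a $k\times m$ binary matrix (ordinary integer arithmetic); such a decomposition with $k=R_{binary}(A)$ is an optimal binary decomposition. A set $S$ of binary vectors spans a set $T$ if every vector of $T$ is the (ordinary) sum of some subset of $S$. A base of $A$ is a set of binary vectors in $\{0,1\}^n$ spanning all columns of $A$, of minimum cardinality among such sets. $A$ has the Unique base rows sums property if for every optimal binary decomposition $A=X\cdot Y$, the matrix $Y$ does not contain two disjoint nonempty subsets of rows $y_{i_1},\dots,y_{i_s}$ and $y_{j_1},\dots,y_{j_t}$ with $y_{i_1}+\dots+y_{i_s}=y_{j_1}+\dots+y_{j_t}$. $A$ has the Augmentation property for the binary rank if for any binary column vectors $x_1,\dots,x_t$ with $R_{binary}(A|x_i)=R_{binary}(A)$ for all $i$, also $R_{binary}(A|x_1,\dots,x_t)=R_{binary}(A)$, where $(A|x_1,\dots,x_t)$ is $A$ with the columns $x_1,\dots,x_t$ appended. -}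

module Defs where

open import Data.Nat using (ℕ; zero; suc; _+_; _*_; _≤_)
open import Data.Bool using (Bool; true; false)
open import Data.Fin using (Fin; zero; suc; splitAt)
open import Data.Sum using ([_,_]′)
open import Data.Vec using (Vec; tabulate; zipWith; replicate)
open import Data.List using (List; length)
open import Data.List.Relation.Unary.All using (All)
open import Data.List.Relation.Unary.Unique.Propositional using (Unique)
open import Data.List.Membership.Propositional using (_∈_)
open import Data.Product using (Σ; ∃; _×_)
open import Relation.Binary.PropositionalEquality using (_≡_)
open import Relation.Nullary using (¬_)

-- 0/1 value of a bit (binary entries, ordinary integer arithmetic)
b2n : Bool → ℕ
b2n false = 0
b2n true  = 1

sumFin : ∀ k → (Fin k → ℕ) → ℕ
sumFin zero    f = 0
sumFin (suc k) f = f zero + sumFin k (λ i → f (suc i))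

Mat : ℕ → ℕ → Set
Mat n m = Fin n → Fin m → Bool

IsProduct : ∀ {n m k} → Mat n m → Mat n k → Mat k m → Set
IsProduct {n} {m} {k} A X Y =
  ∀ i j → b2n (A i j) ≡ sumFin k (λ l → b2n (X i l) * b2n (Y l j))

HasDecomp : ∀ {n m} → Mat n m → ℕ → Set
HasDecomp {n} {m} A k = Σ (Mat n k) λ X → Σ (Mat k m) λ Y → IsProduct A X Y

IsBinaryRank : ∀ {n m} → Mat n m → ℕ → Set
IsBinaryRank A r = HasDecomp A r × (∀ k → HasDecomp A k → r ≤ k)

BVec : ℕ → Set
BVec n = Vec Bool n

column : ∀ {n m} → Mat n m → Fin m → BVec n
column A j = tabulate (λ i → A i j)

columns : ∀ {n m} → Mat n m → List (BVec n)
columns {m = m} A = Data.List.tabulate {n = m} (column A)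

vsum : ∀ {n} → List (BVec n) → Vec ℕ n
vsum {n} List.[] = replicate n 0
vsum (v List.∷ vs) = zipWith _+_ (Data.Vec.map b2n v) (vsum vs)

-- the set S (a finite list, duplicates irrelevant) spans vector v :
-- v is the sum of some subset of S
SpansVec : ∀ {n} → List (BVec n) → BVec n → Set
SpansVec {n} S v = ∃ λ (L : List (BVec n)) →
  Unique L × All (_∈ S) L × Data.Vec.map b2n v ≡ vsum L

Spans : ∀ {n} → List (BVec n) → List (BVec n) → Set
Spans S T = All (SpansVec S) T

IsBase : ∀ {n m} → Mat n m → List (BVec n) → Set
IsBase {n} A B =
  Unique B × Spans B (columns A) ×
  (∀ (B′ : List (BVec n)) → Unique B′ → Spans B′ (columns A) → length B ≤ length B′)

UniqueBaseRowsSums : ∀ {n m} → Mat n m → Set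
UniqueBaseRowsSums {n} {m} A =
  ∀ r → IsBinaryRank A r → (X : Mat n r) (Y : Mat r m) → IsProduct A X Y →
  ∀ (I J : Fin r → Bool) →
  (∀ i → ¬ (I i ≡ true × J i ≡ true)) →
  (∃ λ i → I i ≡ true) → (∃ λ i → J i ≡ true) →
  ¬ (∀ j → sumFin r (λ i → b2n (I i) * b2n (Y i j))
         ≡ sumFin r (λ i → b2n (J i) * b2n (Y i j)))

appendCols : ∀ {n m t} → Mat n m → Mat n t → Mat n (m + t)
appendCols {m = m} A C i j = [ A i , C i ]′ (splitAt m j)

colMat : ∀ {n} → (Fin n → Bool) → Mat n 1
colMat x i _ = x i

Augmentation : ∀ {n m} → Mat n m → Set
Augmentation {n} {m} A =
  ∀ r → IsBinaryRank A r →
  ∀ t (xs : Fin t → Fin n → Bool) →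
  (∀ l → IsBinaryRank (appendCols A (colMat (xs l))) r) →
  IsBinaryRank (appendCols A (λ i l → xs l i)) r

module Submission where

-- Let σ pick the rows of A forming V, so that A = U · (A ∘ σ). If A = X · Y is any optimal
-- decomposition, row a of A is both X a · Y and (U a · (X ∘ σ)) · Y. The natural vector
-- U a · (X ∘ σ) is 0/1 because Y has no zero row, and the unique base rows sums property then
-- makes it equal to X a; hence X = U · (X ∘ σ), so each column of X is a sum of distinct
-- columns of U. A base B gives an optimal decomposition whose left factor has the columns B.
-- If (A | x) still has rank r, an optimal decomposition W · Y of it restricts to one of A, so
-- W = U · (W ∘ σ) and x = U · (x ∘ σ); thus (A | x₁ … xₜ) = U · ((A | x₁ … xₜ) ∘ σ) has rank r.

open import Defs
open import Data.Nat using (ℕ; zero; suc; _+_; _*_; _≤_; z≤n; s≤s)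
open import Data.Nat.Properties
open import Algebra.Properties.Semiring.Sum +-*-semiring
  using (sum; sum-cong-≗; ∑-distrib-+; ∑-comm; *-distribˡ-sum; *-distribʳ-sum;
         sum-remove; sum-replicate-zero)
open import Data.Bool using (Bool; true; false; _∧_; _∨_; not)
open import Data.Bool.Properties using () renaming (_≟_ to _≟ᵇ_)
open import Data.Fin using (Fin; zero; suc; splitAt; _↑ˡ_; _↑ʳ_; punchOut)
open import Data.Fin.Properties using (any?; splitAt-↑ˡ; splitAt-↑ʳ; punchIn-punchOut)
import Data.Fin.Properties as Finₚ
open import Data.Vec using (lookup; tabulate)
import Data.Vec as Vec
import Data.Vec.Properties as Vecₚ
open import Data.Vec.Functional using (removeAt)
open import Data.List using (List; []; _∷_; length; deduplicate)
import Data.List as List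
open import Data.List.Properties using (length-deduplicate; length-tabulate)
import Data.List.Properties as Listₚ
open import Data.List.Relation.Unary.All using (All; []; _∷_)
import Data.List.Relation.Unary.All as All
open import Data.List.Relation.Unary.All.Properties using (tabulate⁺; tabulate⁻)
open import Data.List.Relation.Unary.Any using (here; there)
open import Data.List.Relation.Unary.Unique.Propositional using (Unique)
import Data.List.Relation.Unary.Unique.DecPropositional.Properties as Uniqueₚ
open import Data.List.Relation.Unary.AllPairs using ([]; _∷_)
open import Data.List.Membership.Propositional using (_∈_)
open import Data.List.Membership.Propositional.Properties
  using (∈-lookup; ∈-tabulate⁺; ∈-deduplicate⁺)
open import Data.Product using (∃; _×_; _,_; proj₁; proj₂)
import Data.Product as Product
open import Data.Sum using ([_,_]′; inj₁; inj₂)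
open import Data.Empty using (⊥; ⊥-elim)
open import Function using (_∘_; id)
open import Relation.Binary.Definitions using (DecidableEquality)
open import Relation.Nullary using (¬_; yes; no; does; contradiction)
open import Relation.Nullary.Decidable using (dec-true; dec-false)
open import Relation.Binary.PropositionalEquality

private
  variable
    n m k r t : ℕ

b2n≤1 : ∀ b → b2n b ≤ 1
b2n≤1 false = z≤n
b2n≤1 true  = s≤s z≤n

≤1⇒bit : ∀ {x} → x ≤ 1 → ∃ λ b → b2n b ≡ x
≤1⇒bit z≤n       = false , refl
≤1⇒bit (s≤s z≤n) = true , refl

b2n-≢true : ∀ {b} → b ≢ true → b2n b ≡ 0
b2n-≢true {false} _ = refl
b2n-≢true {true}  b≢true = contradiction refl b≢true

b2n-∨ : ∀ a b → (a ≡ true → b ≡ true → ⊥) → b2n (a ∨ b) ≡ b2n a + b2n b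
b2n-∨ true  true  a∧b = ⊥-elim (a∧b refl refl)
b2n-∨ true  false _   = refl
b2n-∨ false b     _   = refl

-- both sides equal b2n (b ∨ c) * y
b2n-∨-split : ∀ b c y →
  b2n b * y + b2n (c ∧ not b) * y ≡ b2n c * y + b2n (b ∧ not c) * y
b2n-∨-split true  true  y = refl
b2n-∨-split true  false y = +-comm (y + 0) 0
b2n-∨-split false true  y = +-comm 0 (y + 0)
b2n-∨-split false false y = refl

∖-disjoint : ∀ b c → ¬ (b ∧ not c ≡ true × c ∧ not b ≡ true)
∖-disjoint true  true  (() , _)
∖-disjoint true  false (_ , ())
∖-disjoint false c     (() , _)

∖-empty⇒≡ : ∀ b c → b ∧ not c ≢ true → c ∧ not b ≢ true → b ≡ c
∖-empty⇒≡ false false _    _    = refl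
∖-empty⇒≡ false true  _    c∖b  = contradiction refl c∖b
∖-empty⇒≡ true  false b∖c  _    = contradiction refl b∖c
∖-empty⇒≡ true  true  _    _    = refl

sumFin≡sum : ∀ k (f : Fin k → ℕ) → sumFin k f ≡ sum f
sumFin≡sum zero    f = refl
sumFin≡sum (suc k) f = cong (f zero +_) (sumFin≡sum k (f ∘ suc))

sumFin-cong : ∀ k {f g : Fin k → ℕ} → f ≗ g → sumFin k f ≡ sumFin k g
sumFin-cong k {f} {g} f≗g =
  trans (sumFin≡sum k f) (trans (sum-cong-≗ f≗g) (sym (sumFin≡sum k g)))

sumFin-zero : ∀ k → sumFin k (λ _ → 0) ≡ 0
sumFin-zero k = trans (sumFin≡sum k _) (sum-replicate-zero k)

sumFin-distrib-+ : ∀ k (f g : Fin k → ℕ) →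
  sumFin k (λ i → f i + g i) ≡ sumFin k f + sumFin k g
sumFin-distrib-+ k f g = begin
  sumFin k (λ i → f i + g i) ≡⟨ sumFin≡sum k _ ⟩
  sum (λ i → f i + g i)      ≡⟨ ∑-distrib-+ f g ⟩
  sum f + sum g              ≡⟨ cong₂ _+_ (sumFin≡sum k f) (sumFin≡sum k g) ⟨
  sumFin k f + sumFin k g    ∎
  where open ≡-Reasoning

sumFin-remove : ∀ k (f : Fin (suc k) → ℕ) p →
  sumFin (suc k) f ≡ f p + sumFin k (removeAt f p)
sumFin-remove k f p = begin
  sumFin (suc k) f               ≡⟨ sumFin≡sum (suc k) f ⟩
  sum f                          ≡⟨ sum-remove f ⟩
  f p + sum (removeAt f p)       ≡⟨ cong (f p +_) (sumFin≡sum k _) ⟨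
  f p + sumFin k (removeAt f p)  ∎
  where open ≡-Reasoning

sumFin-term≤ : ∀ k (f : Fin k → ℕ) p → f p ≤ sumFin k f
sumFin-term≤ (suc k) f p = ≤-trans (m≤m+n (f p) _) (≤-reflexive (sym (sumFin-remove k f p)))

sumFin-two-terms≤ : ∀ k (f : Fin k → ℕ) {p q} → p ≢ q → f p + f q ≤ sumFin k f
sumFin-two-terms≤ (suc k) f {p} {q} p≢q = begin
  f p + f q                              ≡⟨ cong (λ l → f p + f l) (punchIn-punchOut p≢q) ⟨
  f p + removeAt f p (punchOut p≢q)      ≤⟨ +-monoʳ-≤ (f p) (sumFin-term≤ k (removeAt f p) _) ⟩
  f p + sumFin k (removeAt f p)          ≡⟨ sumFin-remove k f p ⟨
  sumFin (suc k) f                       ∎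
  where open ≤-Reasoning

sumFin-assoc : ∀ r k (u : Fin r → ℕ) (w : Fin r → Fin k → ℕ) (y : Fin k → ℕ) →
  sumFin k (λ q → sumFin r (λ p → u p * w p q) * y q)
    ≡ sumFin r (λ p → u p * sumFin k (λ q → w p q * y q))
sumFin-assoc r k u w y = begin
  sumFin k (λ q → sumFin r (λ p → u p * w p q) * y q)
    ≡⟨ trans (sumFin≡sum k _) (sum-cong-≗ λ q → cong (_* y q) (sumFin≡sum r _)) ⟩
  sum (λ q → sum (λ p → u p * w p q) * y q)
    ≡⟨ sum-cong-≗ (λ q → *-distribʳ-sum (y q) (λ p → u p * w p q)) ⟩
  sum (λ q → sum (λ p → u p * w p q * y q))
    ≡⟨ ∑-comm (λ q p → u p * w p q * y q) ⟩
  sum (λ p → sum (λ q → u p * w p q * y q))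
    ≡⟨ sum-cong-≗ (λ p → trans (sum-cong-≗ λ q → *-assoc (u p) (w p q) (y q))
                                (sym (*-distribˡ-sum (u p) (λ q → w p q * y q)))) ⟩
  sum (λ p → u p * sum (λ q → w p q * y q))
    ≡⟨ trans (sumFin≡sum r _) (sum-cong-≗ λ p → cong (u p *_) (sumFin≡sum k _)) ⟨
  sumFin r (λ p → u p * sumFin k (λ q → w p q * y q)) ∎
  where open ≡-Reasoning

rowsSum : (Fin k → Bool) → Mat k m → Fin m → ℕ
rowsSum {k} I Y j = sumFin k (λ i → b2n (I i) * b2n (Y i j))

IsProduct-congʳ : {A : Mat n m} {X : Mat n k} {Y Y′ : Mat k m} →
  (∀ l j → Y l j ≡ Y′ l j) → IsProduct A X Y → IsProduct A X Y′
IsProduct-congʳ {k = k} {X = X} Y≡Y′ A≡XY i j =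
  trans (A≡XY i j) (sumFin-cong k λ l → cong (λ y → b2n (X i l) * b2n y) (Y≡Y′ l j))

IsProduct-removeAt : {A : Mat n m} {X : Mat n (suc k)} {Y : Mat (suc k) m} →
  IsProduct A X Y → ∀ p → (∀ i j → b2n (X i p) * b2n (Y p j) ≡ 0) →
  IsProduct A (λ i → removeAt (X i) p) (removeAt Y p)
IsProduct-removeAt {k = k} {X = X} {Y} A≡XY p vanishes i j =
  trans (A≡XY i j) (trans (sumFin-remove k term p) (cong (_+ sumFin k (removeAt term p)) (vanishes i j)))
  where
  term : Fin (suc k) → ℕ
  term l = b2n (X i l) * b2n (Y l j)

FactorsThroughRows : Mat n r → (Fin r → Fin n) → Mat n m → Set
FactorsThroughRows U σ M = IsProduct M U (M ∘ σ)

FactorsThroughRows-product : {C : Mat n m} {W : Mat n k} {Z : Mat k m} (U : Mat n r) (σ : Fin r → Fin n) →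
  FactorsThroughRows U σ W → IsProduct C W Z → FactorsThroughRows U σ C
FactorsThroughRows-product {k = k} {r = r} {C = C} {W} {Z} U σ W≡UWσ C≡WZ a j = begin
  b2n (C a j)
    ≡⟨ C≡WZ a j ⟩
  sumFin k (λ q → b2n (W a q) * b2n (Z q j))
    ≡⟨ sumFin-cong k (λ q → cong (_* b2n (Z q j)) (W≡UWσ a q)) ⟩
  sumFin k (λ q → sumFin r (λ p → b2n (U a p) * b2n (W (σ p) q)) * b2n (Z q j))
    ≡⟨ sumFin-assoc r k (λ p → b2n (U a p)) (λ p q → b2n (W (σ p) q)) (λ q → b2n (Z q j)) ⟩
  sumFin r (λ p → b2n (U a p) * sumFin k (λ q → b2n (W (σ p) q) * b2n (Z q j)))
    ≡⟨ sumFin-cong r (λ p → cong (b2n (U a p) *_) (C≡WZ (σ p) j)) ⟨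
  sumFin r (λ p → b2n (U a p) * b2n (C (σ p) j)) ∎
  where open ≡-Reasoning

IsProduct-appendCols⁺ : {A : Mat n m} {C : Mat n t} {X : Mat n k} {Y : Mat k m} {Z : Mat k t} →
  IsProduct A X Y → IsProduct C X Z → IsProduct (appendCols A C) X (appendCols Y Z)
IsProduct-appendCols⁺ {m = m} A≡XY C≡XZ i j with splitAt m j
... | inj₁ j′ = A≡XY i j′
... | inj₂ j′ = C≡XZ i j′

appendCols-↑ˡ : (A : Mat n m) (C : Mat n t) (i : Fin n) (j : Fin m) → appendCols A C i (j ↑ˡ t) ≡ A i j
appendCols-↑ˡ {m = m} {t = t} A C i j = cong [ A i , C i ]′ (splitAt-↑ˡ m j t)

appendCols-↑ʳ : (A : Mat n m) (C : Mat n t) (i : Fin n) (j : Fin t) → appendCols A C i (m ↑ʳ j) ≡ C i j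
appendCols-↑ʳ {m = m} {t = t} A C i j = cong [ A i , C i ]′ (splitAt-↑ʳ m t j)

IsProduct-appendCols⁻ˡ : {A : Mat n m} {C : Mat n t} {X : Mat n k} {Y : Mat k (m + t)} →
  IsProduct (appendCols A C) X Y → IsProduct A X (λ l j → Y l (j ↑ˡ t))
IsProduct-appendCols⁻ˡ {m = m} {t = t} {A = A} {C} AC≡XY i j =
  trans (cong b2n (sym (appendCols-↑ˡ A C i j))) (AC≡XY i (j ↑ˡ t))

IsProduct-appendCols⁻ʳ : {A : Mat n m} {C : Mat n t} {X : Mat n k} {Y : Mat k (m + t)} →
  IsProduct (appendCols A C) X Y → IsProduct C X (λ l j → Y l (m ↑ʳ j))
IsProduct-appendCols⁻ʳ {m = m} {t = t} {A = A} {C} AC≡XY i j =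
  trans (cong b2n (sym (appendCols-↑ʳ A C i j))) (AC≡XY i (m ↑ʳ j))

HasDecomp-appendCols⁻ : {A : Mat n m} {C : Mat n t} → HasDecomp (appendCols A C) k → HasDecomp A k
HasDecomp-appendCols⁻ {t = t} {A = A} {C} (X , Y , AC≡XY) =
  X , (λ l j → Y l (j ↑ˡ t)) , IsProduct-appendCols⁻ˡ {A = A} {C} {X} {Y} AC≡XY

FactorsThroughRows-appendCols⁺ : {A : Mat n m} {C : Mat n t} (U : Mat n r) (σ : Fin r → Fin n) →
  FactorsThroughRows U σ A → FactorsThroughRows U σ C → FactorsThroughRows U σ (appendCols A C)
FactorsThroughRows-appendCols⁺ {A = A} {C} U σ =
  IsProduct-appendCols⁺ {A = A} {C} {U} {A ∘ σ} {C ∘ σ}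

FactorsThroughRows-appendCols⁻ʳ : {A : Mat n m} {C : Mat n t} (U : Mat n r) (σ : Fin r → Fin n) →
  FactorsThroughRows U σ (appendCols A C) → FactorsThroughRows U σ C
FactorsThroughRows-appendCols⁻ʳ {A = A} {C} U σ AC-factors =
  IsProduct-congʳ {X = U} (λ p j → appendCols-↑ʳ A C (σ p) j)
    (IsProduct-appendCols⁻ʳ {A = A} {C} {U} AC-factors)

IsBinaryRank-unique : {A : Mat n m} → IsBinaryRank A r → IsBinaryRank A k → r ≡ k
IsBinaryRank-unique (decʳ , minʳ) (decᵏ , minᵏ) = ≤-antisym (minʳ _ decᵏ) (minᵏ _ decʳ)

optimal⇒terms-nonvanishing : {A : Mat n m} → IsBinaryRank A r →
  (X : Mat n r) (Y : Mat r m) → IsProduct A X Y → ∀ p → ¬ (∀ i j → b2n (X i p) * b2n (Y p j) ≡ 0)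
optimal⇒terms-nonvanishing {r = suc k} (_ , minimal) X Y A≡XY p vanishes =
  1+n≰n (minimal k ((λ i → removeAt (X i) p) , removeAt Y p ,
                    IsProduct-removeAt {X = X} {Y} A≡XY p vanishes))

optimal⇒nonzero-rows : {A : Mat n m} → IsBinaryRank A r →
  (X : Mat n r) (Y : Mat r m) → IsProduct A X Y → ∀ p → ∃ λ j → Y p j ≡ true
optimal⇒nonzero-rows rank X Y A≡XY p with any? (λ j → Y p j ≟ᵇ true)
... | yes nonzero = nonzero
... | no zero-row = ⊥-elim (optimal⇒terms-nonvanishing rank X Y A≡XY p λ i j →
  trans (cong (b2n (X i p) *_) (b2n-≢true (λ Ypj → zero-row (j , Ypj)))) (*-zeroʳ (b2n (X i p))))

optimal⇒nonzero-columns : {A : Mat n m} → IsBinaryRank A r →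
  (X : Mat n r) (Y : Mat r m) → IsProduct A X Y → ∀ p → ∃ λ i → X i p ≡ true
optimal⇒nonzero-columns rank X Y A≡XY p with any? (λ i → X i p ≟ᵇ true)
... | yes nonzero = nonzero
... | no zero-column = ⊥-elim (optimal⇒terms-nonvanishing rank X Y A≡XY p λ i j →
  cong (_* b2n (Y p j)) (b2n-≢true (λ Xip → zero-column (i , Xip))))

_∖_ : (Fin k → Bool) → (Fin k → Bool) → Fin k → Bool
(b ∖ c) i = b i ∧ not (c i)

rowsSum-excess : (b c : Fin k → Bool) (Y : Mat k m) →
  (∀ j → rowsSum b Y j ≡ rowsSum c Y j) → ∀ j → rowsSum (b ∖ c) Y j ≡ rowsSum (c ∖ b) Y j
rowsSum-excess {k} b c Y b≡c j = sym (+-cancelˡ-≡ (rowsSum b Y j) _ _ (begin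
  rowsSum b Y j + rowsSum (c ∖ b) Y j
    ≡⟨ sumFin-distrib-+ k _ _ ⟨
  sumFin k (λ i → b2n (b i) * b2n (Y i j) + b2n ((c ∖ b) i) * b2n (Y i j))
    ≡⟨ sumFin-cong k (λ i → b2n-∨-split (b i) (c i) (b2n (Y i j))) ⟩
  sumFin k (λ i → b2n (c i) * b2n (Y i j) + b2n ((b ∖ c) i) * b2n (Y i j))
    ≡⟨ sumFin-distrib-+ k _ _ ⟩
  rowsSum c Y j + rowsSum (b ∖ c) Y j
    ≡⟨ cong (_+ rowsSum (b ∖ c) Y j) (b≡c j) ⟨
  rowsSum b Y j + rowsSum (b ∖ c) Y j ∎))
  where open ≡-Reasoning

module _ {A : Mat n m} (ubrs : UniqueBaseRowsSums A) (rank : IsBinaryRank A k)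
         (X : Mat n k) (Y : Mat k m) (A≡XY : IsProduct A X Y) where

  rowsSum-≡⇒no-excess : (b c : Fin k → Bool) → (∀ j → rowsSum b Y j ≡ rowsSum c Y j) →
    ∀ p → (b ∖ c) p ≢ true
  rowsSum-≡⇒no-excess b c b≡c p p∈b∖c with any? (λ i → (c ∖ b) i ≟ᵇ true)
  ... | yes c∖b≢∅ = ubrs k rank X Y A≡XY (b ∖ c) (c ∖ b)
                      (λ i → ∖-disjoint (b i) (c i)) (p , p∈b∖c) c∖b≢∅ (rowsSum-excess b c Y b≡c)
  ... | no c∖b≡∅ = 1+n≰n (begin
    1                             ≡⟨ cong₂ (λ x y → b2n x * b2n y) p∈b∖c Ypj ⟨
    b2n ((b ∖ c) p) * b2n (Y p j) ≤⟨ sumFin-term≤ k _ p ⟩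
    rowsSum (b ∖ c) Y j           ≡⟨ rowsSum-excess b c Y b≡c j ⟩
    rowsSum (c ∖ b) Y j           ≡⟨ sumFin-cong k (λ i → cong (_* b2n (Y i j)) (c∖b-vanishes i)) ⟩
    sumFin k (λ _ → 0)            ≡⟨ sumFin-zero k ⟩
    0                             ∎)
    where
    open ≤-Reasoning
    j = proj₁ (optimal⇒nonzero-rows rank X Y A≡XY p)
    Ypj = proj₂ (optimal⇒nonzero-rows rank X Y A≡XY p)
    c∖b-vanishes : ∀ i → b2n ((c ∖ b) i) ≡ 0
    c∖b-vanishes i = b2n-≢true (λ i∈c∖b → c∖b≡∅ (i , i∈c∖b))

  rowsSum-injective : (b c : Fin k → Bool) → (∀ j → rowsSum b Y j ≡ rowsSum c Y j) →
    ∀ p → b p ≡ c p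
  rowsSum-injective b c b≡c p = ∖-empty⇒≡ (b p) (c p)
    (rowsSum-≡⇒no-excess b c b≡c p) (rowsSum-≡⇒no-excess c b (sym ∘ b≡c) p)

  optimal⇒FactorsThroughRows : (U : Mat n r) (σ : Fin r → Fin n) →
    FactorsThroughRows U σ A → FactorsThroughRows U σ X
  optimal⇒FactorsThroughRows {r} U σ A≡UAσ a q =
    trans (cong b2n (rowsSum-injective (X a) (proj₁ ∘ bit) Xa≡bits q)) (proj₂ (bit q))
    where
    N : Fin k → ℕ
    N q = sumFin r (λ p → b2n (U a p) * b2n (X (σ p) q))
    A≡NY : ∀ j → b2n (A a j) ≡ sumFin k (λ q → N q * b2n (Y q j))
    A≡NY j = begin
      b2n (A a j)                                    ≡⟨ A≡UAσ a j ⟩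
      sumFin r (λ p → b2n (U a p) * b2n (A (σ p) j))
        ≡⟨ sumFin-cong r (λ p → cong (b2n (U a p) *_) (A≡XY (σ p) j)) ⟩
      sumFin r (λ p → b2n (U a p) * rowsSum (X (σ p)) Y j)
        ≡⟨ sumFin-assoc r k (λ p → b2n (U a p)) (λ p q → b2n (X (σ p) q)) (λ q → b2n (Y q j)) ⟨
      sumFin k (λ q → N q * b2n (Y q j))             ∎
      where open ≡-Reasoning
    N≤1 : ∀ q → N q ≤ 1
    N≤1 q = begin
      N q                                ≡⟨ *-identityʳ (N q) ⟨
      N q * 1                            ≡⟨ cong (λ y → N q * b2n y) Yqj ⟨
      N q * b2n (Y q j)                  ≤⟨ sumFin-term≤ k (λ q′ → N q′ * b2n (Y q′ j)) q ⟩
      sumFin k (λ q′ → N q′ * b2n (Y q′ j)) ≡⟨ A≡NY j ⟨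
      b2n (A a j)                        ≤⟨ b2n≤1 (A a j) ⟩
      1                                  ∎
      where
      open ≤-Reasoning
      j = proj₁ (optimal⇒nonzero-rows rank X Y A≡XY q)
      Yqj = proj₂ (optimal⇒nonzero-rows rank X Y A≡XY q)
    bit : ∀ q → ∃ λ b → b2n b ≡ N q
    bit q = ≤1⇒bit (N≤1 q)
    Xa≡bits : ∀ j → rowsSum (X a) Y j ≡ rowsSum (proj₁ ∘ bit) Y j
    Xa≡bits j = trans (sym (A≡XY a j)) (trans (A≡NY j)
      (sumFin-cong k λ q → cong (_* b2n (Y q j)) (sym (proj₂ (bit q)))))

lookup-vsum-[] : ∀ (i : Fin n) → lookup (vsum []) i ≡ 0
lookup-vsum-[] {n} i = Vecₚ.lookup-replicate i 0

lookup-vsum-∷ : ∀ (v : BVec n) vs i → lookup (vsum (v ∷ vs)) i ≡ b2n (lookup v i) + lookup (vsum vs) i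
lookup-vsum-∷ v vs i =
  trans (Vecₚ.lookup-zipWith _+_ i (Vec.map b2n v) (vsum vs)) (cong (_+ _) (Vecₚ.lookup-map i b2n v))

map-b2n-column≡vsum : (C : Mat n m) (j : Fin m) (L : List (BVec n)) →
  (∀ i → b2n (C i j) ≡ lookup (vsum L) i) → Vec.map b2n (column C j) ≡ vsum L
map-b2n-column≡vsum C j L C≡L = begin
  Vec.map b2n (tabulate (λ i → C i j)) ≡⟨ Vecₚ.tabulate-∘ b2n (λ i → C i j) ⟨
  tabulate (λ i → b2n (C i j))         ≡⟨ Vecₚ.tabulate-cong C≡L ⟩
  tabulate (lookup (vsum L))           ≡⟨ Vecₚ.tabulate∘lookup (vsum L) ⟩
  vsum L                               ∎
  where open ≡-Reasoning

consIf : {X : Set} → Bool → X → List X → List X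
consIf true  x xs = x ∷ xs
consIf false x xs = xs

select : {X : Set} → (Fin k → Bool) → (Fin k → X) → List X
select {zero}  s f = []
select {suc k} s f = consIf (s zero) (f zero) (select (s ∘ suc) (f ∘ suc))

∈-select⁻ : {X : Set} (s : Fin k → Bool) (f : Fin k → X) {y : X} →
  y ∈ select s f → ∃ λ l → s l ≡ true × y ≡ f l
∈-select⁻ {suc k} s f y∈ with s zero in s₀ | y∈
... | true  | here y≡f₀ = zero , s₀ , y≡f₀
... | true  | there y∈′ = Product.map suc id (∈-select⁻ (s ∘ suc) (f ∘ suc) y∈′)
... | false | y∈′       = Product.map suc id (∈-select⁻ (s ∘ suc) (f ∘ suc) y∈′)

consIf-unique : {X : Set} (b : Bool) (x : X) {xs : List X} →
  (b ≡ true → All (x ≢_) xs) → Unique xs → Unique (consIf b x xs)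
consIf-unique true  x x∉xs xs! = x∉xs refl ∷ xs!
consIf-unique false x _    xs! = xs!

select-unique : {X : Set} (s : Fin k → Bool) (f : Fin k → X) →
  (∀ l₁ l₂ → s l₁ ≡ true → s l₂ ≡ true → f l₁ ≡ f l₂ → l₁ ≡ l₂) → Unique (select s f)
select-unique {zero}  s f f-inj = []
select-unique {suc k} s f f-inj = consIf-unique (s zero) (f zero)
  (λ s₀ → All.tabulate (f₀∉ s₀))
  (select-unique (s ∘ suc) (f ∘ suc) λ l₁ l₂ s₁ s₂ →
    Finₚ.suc-injective ∘ f-inj (suc l₁) (suc l₂) s₁ s₂)
  where
  f₀∉ : s zero ≡ true → ∀ {y} → y ∈ select (s ∘ suc) (f ∘ suc) → f zero ≢ y
  f₀∉ s₀ y∈ f₀≡y with ∈-select⁻ (s ∘ suc) (f ∘ suc) y∈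
  ... | l , sl , refl with () ← f-inj zero (suc l) s₀ sl f₀≡y

lookup-vsum-select : (s : Fin k → Bool) (f : Fin k → BVec n) (i : Fin n) →
  lookup (vsum (select s f)) i ≡ sumFin k (λ l → b2n (s l) * b2n (lookup (f l) i))
lookup-vsum-select {zero}  s f i = lookup-vsum-[] i
lookup-vsum-select {suc k} s f i with s zero
... | true  = trans (lookup-vsum-∷ (f zero) (select (s ∘ suc) (f ∘ suc)) i)
                (cong₂ _+_ (sym (+-identityʳ _)) (lookup-vsum-select (s ∘ suc) (f ∘ suc) i))
... | false = lookup-vsum-select (s ∘ suc) (f ∘ suc) i

-- Column j of C is the sum of the columns of U selected by column j of S. These are distinct:
-- two equal nonzero columns would put a 2 into the binary column C j.
IsProduct⇒Spans : (U : Mat n r) → (∀ l → ∃ λ a → U a l ≡ true) →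
  (C : Mat n m) (S : Mat r m) → IsProduct C U S → Spans (columns U) (columns C)
IsProduct⇒Spans {r = r} U U-nonzero C S C≡US = tabulate⁺ column-spanned
  where
  column-spanned : ∀ j → SpansVec (columns U) (column C j)
  column-spanned j = L , select-unique s (column U) selected-injective , All.tabulate selected∈columns ,
    map-b2n-column≡vsum C j L C≡vsumL
    where
    s : Fin r → Bool
    s l = S l j
    L = select s (column U)
    column-entry : ∀ l a → lookup (column U l) a ≡ U a l
    column-entry l a = Vecₚ.lookup∘tabulate (λ i → U i l) a
    selected∈columns : ∀ {y} → y ∈ L → y ∈ columns U
    selected∈columns y∈ with ∈-select⁻ s (column U) y∈
    ... | l , _ , refl = ∈-tabulate⁺ l
    C≡vsumL : ∀ a → b2n (C a j) ≡ lookup (vsum L) a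
    C≡vsumL a = begin
      b2n (C a j)
        ≡⟨ C≡US a j ⟩
      sumFin r (λ l → b2n (U a l) * b2n (s l))
        ≡⟨ sumFin-cong r (λ l → trans (*-comm (b2n (U a l)) (b2n (s l)))
                                       (cong (λ u → b2n (s l) * b2n u) (sym (column-entry l a)))) ⟩
      sumFin r (λ l → b2n (s l) * b2n (lookup (column U l) a))
        ≡⟨ lookup-vsum-select s (column U) a ⟨
      lookup (vsum L) a ∎
      where open ≡-Reasoning
    column-entries-≡ : ∀ {l₁ l₂} → column U l₁ ≡ column U l₂ → ∀ a → U a l₁ ≡ U a l₂
    column-entries-≡ {l₁} {l₂} U₁≡U₂ a = begin
      U a l₁                 ≡⟨ column-entry l₁ a ⟨
      lookup (column U l₁) a ≡⟨ cong (λ v → lookup v a) U₁≡U₂ ⟩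
      lookup (column U l₂) a ≡⟨ column-entry l₂ a ⟩
      U a l₂                 ∎
      where open ≡-Reasoning
    selected-injective : ∀ l₁ l₂ → s l₁ ≡ true → s l₂ ≡ true → column U l₁ ≡ column U l₂ → l₁ ≡ l₂
    selected-injective l₁ l₂ s₁ s₂ U₁≡U₂ with l₁ Finₚ.≟ l₂
    ... | yes l₁≡l₂ = l₁≡l₂
    ... | no l₁≢l₂ = contradiction (begin
      2                   ≡⟨ cong₂ _+_ (term≡1 l₁ s₁ Ua₁) (term≡1 l₂ s₂ Ua₂) ⟨
      term l₁ + term l₂   ≤⟨ sumFin-two-terms≤ r term l₁≢l₂ ⟩
      sumFin r term       ≡⟨ C≡US a j ⟨
      b2n (C a j)         ≤⟨ b2n≤1 (C a j) ⟩
      1                   ∎) (1+n≰n {1})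
      where
      open ≤-Reasoning
      a = proj₁ (U-nonzero l₁)
      Ua₁ = proj₂ (U-nonzero l₁)
      Ua₂ : U a l₂ ≡ true
      Ua₂ = trans (sym (column-entries-≡ U₁≡U₂ a)) Ua₁
      term : Fin r → ℕ
      term l = b2n (U a l) * b2n (s l)
      term≡1 : ∀ l → s l ≡ true → U a l ≡ true → term l ≡ 1
      term≡1 l sl Ual rewrite sl | Ual = refl

_≟ᵛ_ : DecidableEquality (BVec n)
_≟ᵛ_ = Vecₚ.≡-dec _≟ᵇ_

module _ {n : ℕ} where

  open import Data.List.Membership.DecPropositional (_≟ᵛ_ {n}) using (_∈?_)

  matrixOf : (B : List (BVec n)) → Mat n (length B)
  matrixOf B i q = lookup (List.lookup B q) i

  columns-matrixOf : (B : List (BVec n)) → columns (matrixOf B) ≡ B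
  columns-matrixOf B =
    trans (Listₚ.tabulate-cong (Vecₚ.tabulate∘lookup ∘ List.lookup B)) (Listₚ.tabulate-lookup B)

  sumFin-count-once : (g : BVec n → ℕ) (B : List (BVec n)) → Unique B → ∀ {x} → x ∈ B →
    sumFin (length B) (λ q → g (List.lookup B q) * b2n (does (List.lookup B q ≟ᵛ x))) ≡ g x
  sumFin-count-once g (b ∷ B) (b∉B ∷ B!) (here refl) =
    trans (cong₂ _+_ b-counted others-vanish) (+-identityʳ (g b))
    where
    b-counted : g b * b2n (does (b ≟ᵛ b)) ≡ g b
    b-counted = trans (cong (λ d → g b * b2n d) (dec-true (b ≟ᵛ b) refl)) (*-identityʳ (g b))
    others-vanish : sumFin (length B) (λ q → g (List.lookup B q) * b2n (does (List.lookup B q ≟ᵛ b))) ≡ 0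
    others-vanish = trans (sumFin-cong (length B) λ q →
        trans (cong (λ d → g (List.lookup B q) * b2n d) (dec-false (List.lookup B q ≟ᵛ b) (B[q]≢b q)))
              (*-zeroʳ (g (List.lookup B q))))
      (sumFin-zero (length B))
      where
      B[q]≢b : ∀ q → List.lookup B q ≢ b
      B[q]≢b q = All.lookup b∉B (∈-lookup q) ∘ sym
  sumFin-count-once g (b ∷ B) (b∉B ∷ B!) {x} (there x∈B) = begin
    g b * b2n (does (b ≟ᵛ x)) + rest ≡⟨ cong (λ d → g b * b2n d + rest) (dec-false (b ≟ᵛ x) b≢x) ⟩
    g b * 0 + rest                   ≡⟨ cong (_+ rest) (*-zeroʳ (g b)) ⟩
    rest                             ≡⟨ sumFin-count-once g B B! x∈B ⟩
    g x                              ∎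
    where
    open ≡-Reasoning
    rest = sumFin (length B) (λ q → g (List.lookup B q) * b2n (does (List.lookup B q ≟ᵛ x)))
    b≢x : b ≢ x
    b≢x refl = All.lookup b∉B x∈B refl

  lookup-vsum-sublist : (B L : List (BVec n)) → Unique B → Unique L → All (_∈ B) L → ∀ i →
    lookup (vsum L) i ≡ sumFin (length B) (λ q → b2n (matrixOf B i q) * b2n (does (List.lookup B q ∈? L)))
  lookup-vsum-sublist B [] B! [] [] i = trans (lookup-vsum-[] i) (sym (trans
    (sumFin-cong (length B) λ q → *-zeroʳ (b2n (matrixOf B i q))) (sumFin-zero (length B))))
  lookup-vsum-sublist B (x ∷ L) B! (x∉L ∷ L!) (x∈B ∷ L⊆B) i = begin
    lookup (vsum (x ∷ L)) i
      ≡⟨ lookup-vsum-∷ x L i ⟩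
    b2n (lookup x i) + lookup (vsum L) i
      ≡⟨ cong₂ _+_ (sym (sumFin-count-once (λ v → b2n (lookup v i)) B B! x∈B))
                   (lookup-vsum-sublist B L B! L! L⊆B i) ⟩
    sumFin ℓ (λ q → w q * b2n (is-x q)) + sumFin ℓ (λ q → w q * b2n (in-L q))
      ≡⟨ sumFin-distrib-+ ℓ _ _ ⟨
    sumFin ℓ (λ q → w q * b2n (is-x q) + w q * b2n (in-L q))
      ≡⟨ sumFin-cong ℓ (λ q →
           trans (cong (w q *_) (b2n-∨ _ _ (disjoint q))) (*-distribˡ-+ (w q) _ _)) ⟨
    sumFin ℓ (λ q → w q * b2n (does (List.lookup B q ∈? x ∷ L))) ∎
    where
    open ≡-Reasoning
    ℓ = length B
    w : Fin ℓ → ℕ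
    w q = b2n (matrixOf B i q)
    is-x in-L : Fin ℓ → Bool
    is-x q = does (List.lookup B q ≟ᵛ x)
    in-L q = does (List.lookup B q ∈? L)
    disjoint : ∀ q → is-x q ≡ true → in-L q ≡ true → ⊥
    disjoint q with List.lookup B q ≟ᵛ x | List.lookup B q ∈? L
    ... | yes refl | yes x∈L = λ _ _ → All.lookup x∉L x∈L refl
    ... | yes _    | no _    = λ _ ()
    ... | no _     | _       = λ ()

  Spans⇒IsProduct : (A : Mat n m) (B : List (BVec n)) → Unique B → Spans B (columns A) →
    ∃ λ Y → IsProduct A (matrixOf B) Y
  Spans⇒IsProduct A B B! B-spans = Y , A≡BY
    where
    spanning : ∀ j → SpansVec B (column A j)
    spanning = tabulate⁻ B-spans
    Y : Mat (length B) _
    Y q j = does (List.lookup B q ∈? proj₁ (spanning j))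
    A≡BY : IsProduct A (matrixOf B) Y
    A≡BY i j = let L , L! , L⊆B , Aj≡L = spanning j in begin
      b2n (A i j)                         ≡⟨ cong b2n (Vecₚ.lookup∘tabulate (λ i → A i j) i) ⟨
      b2n (lookup (column A j) i)         ≡⟨ Vecₚ.lookup-map i b2n (column A j) ⟨
      lookup (Vec.map b2n (column A j)) i ≡⟨ cong (λ v → lookup v i) Aj≡L ⟩
      lookup (vsum L) i                   ≡⟨ lookup-vsum-sublist B L B! L! L⊆B i ⟩
      rowsSum (matrixOf B i) Y j          ∎
      where open ≡-Reasoning

Spans-deduplicate : {S T : List (BVec n)} → Spans S T → Spans (deduplicate _≟ᵛ_ S) T
Spans-deduplicate = All.map λ (L , L! , L⊆S , v≡ΣL) →
  L , L! , All.map (∈-deduplicate⁺ _≟ᵛ_) L⊆S , v≡ΣL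

IsBase⇒length≤ : {A : Mat n m} {B : List (BVec n)} → IsBinaryRank A r →
  (U : Mat n r) (V : Mat r m) → IsProduct A U V → IsBase A B → length B ≤ r
IsBase⇒length≤ {r = r} {A = A} {B = B} rank U V A≡UV (_ , _ , minimal) = begin
  length B ≤⟨ minimal (deduplicate _≟ᵛ_ (columns U)) (Uniqueₚ.deduplicate-! _≟ᵛ_ (columns U))
                (Spans-deduplicate (IsProduct⇒Spans U U-nonzero A V A≡UV)) ⟩
  length (deduplicate _≟ᵛ_ (columns U)) ≤⟨ length-deduplicate _≟ᵛ_ (columns U) ⟩
  length (columns U)                    ≡⟨ length-tabulate (column U) ⟩
  r                                     ∎
  where
  open ≤-Reasoning
  U-nonzero = optimal⇒nonzero-columns rank U V A≡UV

IsBase⇒IsBinaryRank : {A : Mat n m} {B : List (BVec n)} → IsBinaryRank A r →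
  (U : Mat n r) (V : Mat r m) → IsProduct A U V → IsBase A B → IsBinaryRank A (length B)
IsBase⇒IsBinaryRank {A = A} {B} rank U V A≡UV base@(B! , B-spans , _) =
  (matrixOf B , Spans⇒IsProduct A B B! B-spans) ,
  λ k dec → ≤-trans (IsBase⇒length≤ rank U V A≡UV base) (proj₂ rank k dec)

IsBinaryRank-appendCols : {A : Mat n m} {C : Mat n t} → IsBinaryRank A r →
  (U : Mat n r) (σ : Fin r → Fin n) → FactorsThroughRows U σ (appendCols A C) →
  IsBinaryRank (appendCols A C) r
IsBinaryRank-appendCols rank U σ AC-factors =
  (U , _ , AC-factors) , λ k dec → proj₂ rank k (HasDecomp-appendCols⁻ dec)

appendCol-factors : {A : Mat n m} → UniqueBaseRowsSums A → IsBinaryRank A k →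
  (U : Mat n r) (σ : Fin r → Fin n) → FactorsThroughRows U σ A →
  (x : Fin n → Bool) → IsBinaryRank (appendCols A (colMat x)) k → FactorsThroughRows U σ (colMat x)
appendCol-factors {A = A} ubrs rank U σ A-factors x ((W , Y , Ax≡WY) , _) =
  FactorsThroughRows-appendCols⁻ʳ {A = A} U σ (FactorsThroughRows-product U σ W-factors Ax≡WY)
  where
  W-factors : FactorsThroughRows U σ W
  W-factors = optimal⇒FactorsThroughRows ubrs rank W (λ q j → Y q (j ↑ˡ 1))
    (IsProduct-appendCols⁻ˡ {A = A} {colMat x} {W} {Y} Ax≡WY) U σ A-factors

theorem2 : ∀ {n m} (A : Mat n m) (r : ℕ) → IsBinaryRank A r →
    (U : Mat n r) (V : Mat r m) → IsProduct A U V →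
    (∀ i → ∃ λ (i′ : Fin n) → ∀ j → V i j ≡ A i′ j) →
    UniqueBaseRowsSums A →
    (∀ (B : List (BVec n)) → IsBase A B → Spans (columns U) B) × Augmentation A
theorem2 {n} A r rank U V A≡UV rows-of-A ubrs = bases-spanned , augmentation
  where
  σ : Fin r → Fin n
  σ = proj₁ ∘ rows-of-A
  A-factors : FactorsThroughRows U σ A
  A-factors = IsProduct-congʳ {X = U} (proj₂ ∘ rows-of-A) A≡UV

  bases-spanned : ∀ B → IsBase A B → Spans (columns U) B
  bases-spanned B base@(B! , B-spans , _) = subst (Spans (columns U)) (columns-matrixOf B)
    (IsProduct⇒Spans U (optimal⇒nonzero-columns rank U V A≡UV) (matrixOf B) (matrixOf B ∘ σ)
      (optimal⇒FactorsThroughRows ubrs (IsBase⇒IsBinaryRank rank U V A≡UV base) (matrixOf B) _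
        (proj₂ (Spans⇒IsProduct A B B! B-spans)) U σ A-factors))

  augmentation : Augmentation A
  augmentation r′ rank′ t xs xs-rank =
    subst (IsBinaryRank (appendCols A X)) (IsBinaryRank-unique rank rank′)
      (IsBinaryRank-appendCols rank U σ (FactorsThroughRows-appendCols⁺ U σ A-factors X-factors))
    where
    X : Mat n t
    X i l = xs l i
    X-factors : FactorsThroughRows U σ X
    X-factors a l = appendCol-factors ubrs rank′ U σ A-factors (xs l) (xs-rank l) a zero
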